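{- Let $w$ be an ss-reducible string. Then $w$ has exactly one nonempty suffix that is an (even) palindrome, and consequently $w$ contains exactly one occurrence of a Z-shape as a substring (which is a suffix of $w$).
   Context: Strings over an alphabet $\Sigma$; $w[i:j]=w[i]\cdots w[j]$ (empty if $j<i$), $\overline{x}$ denotes the reverse of $x$. A palindrome here always means an even palindrome, i.e., a string $x\overline{x}$. A Z-shape is a string $x\overline{x}x$ with $x$ nonempty. The relation $\to$ is defined by $uy\overline{y}yv\to uyv$ for strings $u,v$ and nonempty $y$; a string is reducible if some reduction applies to it (equivalently, it contains a Z-shape as a substring) and irreducible otherwise. A nonempty string $w$ is pp-irreducible if $w[1:|w|-1]$ is irreducible, and ss-reducible if it is reducible and pp-irreducible. -}

module Defs where

open import Data.List using (List; []; _∷_; _++_; reverse)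
open import Data.Product using (Σ; ∃; _×_; _,_)
open import Relation.Binary.PropositionalEquality using (_≡_; _≢_)
open import Relation.Nullary using (¬_)

-- Strings over an arbitrary alphabet A are lists; reverse is the bar operation.

IsZShape : {A : Set} → List A → Set
IsZShape {A} z = Σ (List A) λ x → x ≢ [] × z ≡ x ++ reverse x ++ x

-- a reduction u y ȳ y v → u y v applies to w
Reducible : {A : Set} → List A → Set
Reducible {A} w = Σ (List A) λ u → Σ (List A) λ y → Σ (List A) λ v →
  y ≢ [] × w ≡ u ++ y ++ reverse y ++ y ++ v

Irreducible : {A : Set} → List A → Set
Irreducible w = ¬ Reducible w

PPIrreducible : {A : Set} → List A → Set
PPIrreducible {A} w = Σ (List A) λ w' → Σ A λ a → w ≡ w' ++ (a ∷ []) × Irreducible w'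

SSReducible : {A : Set} → List A → Set
SSReducible w = Reducible w × PPIrreducible w

IsPalindrome : {A : Set} → List A → Set
IsPalindrome {A} p = Σ (List A) λ x → p ≡ x ++ reverse x

IsSuffix : {A : Set} → List A → List A → Set
IsSuffix {A} s w = Σ (List A) λ u → w ≡ u ++ s

NonemptyPalSuffix : {A : Set} → List A → List A → Set
NonemptyPalSuffix w s = s ≢ [] × IsSuffix s w × IsPalindrome s

-- an occurrence of a Z-shape in w: w = u z v with z a Z-shape;
-- an occurrence is identified by its prefix u and the substring z
ZOccurrence : {A : Set} → List A → List A → List A → List A → Set
ZOccurrence w u z v = w ≡ u ++ z ++ v × IsZShape z

module Submission where

-- An ss-reducible string is w = w′ a with w′ irreducible and w reducible.
-- (1) A Z-shape occurrence u z v in w with v nonempty lies inside w′, so every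
--     occurrence ends w; in particular w = u y ȳ y (`ends-in-Z`).
-- (2) Let x x̄ be a nonempty palindromic suffix of w.  Read backwards,
--     r = a · reverse w′ starts both with the Z-shape ȳ y ȳ and with the
--     palindrome x x̄.  If |x| ≠ |y|, a combinatorial lemma on sequences
--     (`interior-Z`, by the cases |x| < |y|, |y| < |x| ≤ 2|y| and 2|y| < |x|)
--     gives a Z-shape in r that starts after its first letter, i.e. one in
--     reverse w′; as reducibility is invariant under reversal, w′ would be
--     reducible.  Hence |x| = |y| (`palindrome-half-length`), so x x̄ = ȳ y.
-- (3) An occurrence u′ x x̄ x ends w, so x̄ x is a palindromic suffix and
--     |x| = |y|; hence the occurrence is u y ȳ y.

open import Defs
open import Data.List using (List; []; _∷_; _++_; _∷ʳ_; reverse; length)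
open import Data.List.Properties
  using ( length-++; length-reverse; length-++-≤ˡ; ++-assoc; ++-identityʳ; ++-conicalʳ
        ; ∷-injective; ∷ʳ-injectiveˡ; unfold-reverse; reverse-++; reverse-involutive; reverse-injective )
open import Data.Maybe using (Maybe; just; nothing)
open import Data.Nat using (ℕ; zero; suc; _+_; _≤_; _<_; z≤n; s≤s)
open import Data.Nat.Properties
open import Data.Nat.Tactic.RingSolver using (solve-∀)
open import Data.Product using (Σ; _×_; _,_; proj₂)
open import Data.Sum using (_⊎_; inj₁; inj₂)
open import Data.Empty using (⊥-elim)
open import Function using (_∘_)
open import Relation.Binary using (tri<; tri≈; tri>)
open import Relation.Binary.PropositionalEquality
  using (_≡_; _≢_; refl; sym; trans; cong; subst; module ≡-Reasoning)
open import Relation.Nullary using (yes; no)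

-- f restricted to the window [j, j + 2L) is an (even) palindrome
Pal : {X : Set} → (ℕ → X) → ℕ → ℕ → Set
Pal f j L = ∀ i k → suc (i + k) ≡ L + L → f (j + i) ≡ f (j + k)

Rep : {X : Set} → (ℕ → X) → ℕ → ℕ → Set
Rep f j L = ∀ i → i < L → f (j + i) ≡ f (j + (L + L + i))

-- f carries a Z-shape x x̄ x with |x| = L at position j
ZAt : {X : Set} → (ℕ → X) → ℕ → ℕ → Set
ZAt f j L = Pal f j L × Rep f j L

mirror : ∀ i k {s} → suc (i + k) ≡ s → suc (k + i) ≡ s
mirror i k h = trans (cong suc (+-comm k i)) h

mirror-below : ∀ {i y L} → suc (i + y) ≡ L → y < L
mirror-below {i} {y} h = subst (y <_) h (s≤s (m≤n+m y i))

≤-from-sum : ∀ {a b c} → a + b ≡ c → a ≤ c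
≤-from-sum {a} {b} e = subst (a ≤_) e (m≤m+n a b)

first-half : ∀ {i k L} → suc (i + k) ≡ L + L → i < L ⊎ k < L
first-half {i} {k} {L} h with i <? L | k <? L
... | yes i<L | _       = inj₁ i<L
... | no _    | yes k<L = inj₂ k<L
... | no i≮L  | no k≮L  = ⊥-elim (1+n≰n (subst (suc (L + L) ≤_) h (s≤s (+-mono-≤ (≮⇒≥ i≮L) (≮⇒≥ k≮L)))))

mirror-of-first-half : ∀ {i k L} → i < L → suc (i + k) ≡ L + L →
                       Σ ℕ λ y → suc (i + y) ≡ L × k ≡ L + y
mirror-of-first-half {i} {k} {L} i<L h with m≤n⇒∃[o]m+o≡n i<L
... | y , hy = y , hy , +-cancelˡ-≡ i k (L + y) (suc-injective (trans h (sym eq)))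
  where
  eq : suc (i + (L + y)) ≡ L + L
  eq = trans (arith i y L) (cong (L +_) hy)
    where
    arith : ∀ i y L → suc (i + (L + y)) ≡ L + suc (i + y)
    arith = solve-∀

pal-from-half : {X : Set} (f : ℕ → X) (j L : ℕ) →
                (∀ i k → i < L → suc (i + k) ≡ L + L → f (j + i) ≡ f (j + k)) → Pal f j L
pal-from-half f j L half i k h with first-half h
... | inj₁ i<L = half i k i<L h
... | inj₂ k<L = sym (half k i k<L (mirror i k h))

pal-centre : {X : Set} (f : ℕ → X) {j c L : ℕ} → Pal f j (c + L) → Pal f (j + c) L
pal-centre f {j} {c} {L} pal i k h =
  begin
    f (j + c + i)   ≡⟨ cong f (+-assoc j c i) ⟩
    f (j + (c + i)) ≡⟨ pal (c + i) (c + k) (trans (arith₁ c i k) (trans (cong (c + c +_) h) (arith₂ c L))) ⟩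
    f (j + (c + k)) ≡⟨ cong f (sym (+-assoc j c k)) ⟩
    f (j + c + k)   ∎
  where
  open ≡-Reasoning
  arith₁ : ∀ c i k → suc ((c + i) + (c + k)) ≡ c + c + suc (i + k)
  arith₁ = solve-∀
  arith₂ : ∀ c L → c + c + (L + L) ≡ (c + L) + (c + L)
  arith₂ = solve-∀

pal-reflect : {X : Set} (f : ℕ → X) {N j J L : ℕ} → Pal f 0 N → Pal f j L →
              j + L + L + J ≡ N + N → Pal f J L
pal-reflect f {N} {j} {J} {L} big small e i k h =
  begin
    f (J + i) ≡⟨ big (J + i) (j + k) (reflected i k h) ⟩
    f (j + k) ≡⟨ sym (small i k h) ⟩
    f (j + i) ≡⟨ sym (big (J + k) (j + i) (reflected k i (mirror i k h))) ⟩
    f (J + k) ∎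
  where
  open ≡-Reasoning
  reflected : ∀ i k → suc (i + k) ≡ L + L → suc ((J + i) + (j + k)) ≡ N + N
  reflected i k h = trans (arith₁ J j i k) (trans (cong (J + j +_) h) (trans (arith₂ J j L) e))
    where
    arith₁ : ∀ J j i k → suc ((J + i) + (j + k)) ≡ J + j + suc (i + k)
    arith₁ = solve-∀
    arith₂ : ∀ J j L → J + j + (L + L) ≡ j + L + L + J
    arith₂ = solve-∀

z-middle-pal : {X : Set} (f : ℕ → X) {n : ℕ} → Pal f 0 n → Rep f 0 n → Pal f n n
z-middle-pal f {n} pal rep = pal-from-half f n n half
  where
  half : ∀ i k → i < n → suc (i + k) ≡ n + n → f (n + i) ≡ f (n + k)
  half i k i<n h with mirror-of-first-half i<n h
  ... | y , hy , refl =
    begin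
      f (n + i)       ≡⟨ pal (n + i) y (trans (arith n i y) (cong (n +_) hy)) ⟩
      f y             ≡⟨ rep y (mirror-below hy) ⟩
      f (n + n + y)   ≡⟨ cong f (+-assoc n n y) ⟩
      f (n + (n + y)) ∎
    where
    open ≡-Reasoning
    arith : ∀ n i y → suc ((n + i) + y) ≡ n + suc (i + y)
    arith = solve-∀

module _ {X : Set} (f : ℕ → X) where

  -- palindrome shorter than the Z-shape (m < n = m + d + 1):
  -- the palindrome reflected inside x x̄ is followed by a copy of its first half
  z-shorter : ∀ m d → let n = m + suc d in
              Pal f 0 n → Rep f 0 n → Pal f 0 m → ZAt f (suc d + suc d) m
  z-shorter m d palN repN palM = pal-reflect f {N = n} {L = m} palN palM (arith₀ m d) , rep
    where
    n = m + suc d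
    J = suc d + suc d
    arith₀ : ∀ m d → m + m + (suc d + suc d) ≡ (m + suc d) + (m + suc d)
    arith₀ = solve-∀
    rep : Rep f J m
    rep i i<m with m≤n⇒∃[o]m+o≡n i<m
    ... | y , hy =
      begin
        f (J + i)           ≡⟨ palN (J + i) (y + m) (trans (arith₁ d m i y) (trans (cong (J + m +_) hy) (arith₂ m d))) ⟩
        f (y + m)           ≡⟨ palM (y + m) i (trans (arith₃ y m i) (cong (_+ m) hy)) ⟩
        f i                 ≡⟨ repN i (≤-trans i<m (m≤m+n m (suc d))) ⟩
        f (n + n + i)       ≡⟨ cong f (arith₄ m d i) ⟩
        f (J + (m + m + i)) ∎
      where
      open ≡-Reasoning
      arith₁ : ∀ d m i y → suc ((suc d + suc d + i) + (y + m)) ≡ suc d + suc d + m + suc (i + y)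
      arith₁ = solve-∀
      arith₂ : ∀ m d → suc d + suc d + m + m ≡ (m + suc d) + (m + suc d)
      arith₂ = solve-∀
      arith₃ : ∀ y m i → suc ((y + m) + i) ≡ suc (i + y) + m
      arith₃ = solve-∀
      arith₄ : ∀ m d i → (m + suc d) + (m + suc d) + i ≡ suc d + suc d + (m + m + i)
      arith₄ = solve-∀

  -- palindrome between n and 2n (m = n + l with n = l + x):
  -- its centre of length 2l, followed by the mirror image of x̄, is a Z-shape
  z-between : ∀ l x → let n = l + x ; m = n + l in
              Pal f 0 n → Pal f 0 m → ZAt f n l
  z-between l x palN palM = pal-centre f palM , rep
    where
    n = l + x
    rep : Rep f n l
    rep i i<l with m≤n⇒∃[o]m+o≡n i<l
    ... | y , hy =
      begin
        f (n + i)           ≡⟨ palN (n + i) (y + x) (trans (arith₁ n i y x) (cong (λ t → n + (t + x)) hy)) ⟩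
        f (y + x)           ≡⟨ sym (palM (n + (l + l + i)) (y + x) (trans (arith₂ n l i y x) (trans (cong (λ t → n + l + l + t + x) hy) (arith₃ l x)))) ⟩
        f (n + (l + l + i)) ∎
      where
      open ≡-Reasoning
      arith₁ : ∀ n i y x → suc ((n + i) + (y + x)) ≡ n + (suc (i + y) + x)
      arith₁ = solve-∀
      arith₂ : ∀ n l i y x → suc ((n + (l + l + i)) + (y + x)) ≡ n + l + l + suc (i + y) + x
      arith₂ = solve-∀
      arith₃ : ∀ l x → (l + x) + l + l + l + x ≡ (l + x + l) + (l + x + l)
      arith₃ = solve-∀

  -- palindrome longer than 2n (m = 2n + s): the middle x̄ x of the Z-shape,
  -- reflected inside the palindrome, is followed by a further copy of x
  z-longer : ∀ n s → let m = n + n + s in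
             Pal f 0 n → Rep f 0 n → Pal f 0 m → ZAt f (n + (s + s)) n
  z-longer n s palN repN palM = pal-reflect f {N = n + n + s} {L = n} palM (z-middle-pal f palN repN) (arith₀ n s) , rep
    where
    J = n + (s + s)
    arith₀ : ∀ n s → n + n + n + (n + (s + s)) ≡ (n + n + s) + (n + n + s)
    arith₀ = solve-∀
    -- both J + i and J + 2n + i mirror n + n + y resp. y in the palindrome
    mirrors : ∀ i y → suc (i + y) ≡ n → suc ((J + i) + (n + n + y)) ≡ (n + n + s) + (n + n + s)
    mirrors i y hy = trans (arith₁ n s i y) (trans (cong (J + n + n +_) hy) (arith₂ n s))
      where
      arith₁ : ∀ n s i y → suc ((n + (s + s) + i) + (n + n + y)) ≡ n + (s + s) + n + n + suc (i + y)
      arith₁ = solve-∀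
      arith₂ : ∀ n s → n + (s + s) + n + n + n ≡ (n + n + s) + (n + n + s)
      arith₂ = solve-∀
    rep : Rep f J n
    rep i i<n with m≤n⇒∃[o]m+o≡n i<n
    ... | y , hy =
      begin
        f (J + i)           ≡⟨ palM (J + i) (n + n + y) (mirrors i y hy) ⟩
        f (n + n + y)       ≡⟨ sym (repN y (mirror-below hy)) ⟩
        f y                 ≡⟨ palM y (J + (n + n + i)) (mirror (J + (n + n + i)) y (trans (cong suc (arith₃ n s i y)) (mirrors i y hy))) ⟩
        f (J + (n + n + i)) ∎
      where
      open ≡-Reasoning
      arith₃ : ∀ n s i y → (n + (s + s) + (n + n + i)) + y ≡ (n + (s + s) + i) + (n + n + y)
      arith₃ = solve-∀

data Shape : ℕ → ℕ → Set where
  shorter : ∀ m d → Shape (suc m + suc d) (suc m)                 -- m < n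
  between : ∀ d x → Shape (suc d + x) (suc d + x + suc d)         -- n < m ≤ 2n
  longer  : ∀ n s → Shape (suc n) (suc n + suc n + suc s)         -- 2n < m

shape : ∀ n m → n ≢ 0 → m ≢ 0 → n ≢ m → Shape n m
shape zero    _       n≢0 _   _   = ⊥-elim (n≢0 refl)
shape (suc n) zero    _   m≢0 _   = ⊥-elim (m≢0 refl)
shape (suc n) (suc m) _   _   n≢m with <-cmp m n
... | tri≈ _ m≡n _ = ⊥-elim (n≢m (cong suc (sym m≡n)))
... | tri< m<n _ _ with m≤n⇒∃[o]m+o≡n m<n
...   | d , refl = subst (λ k → Shape k (suc m)) (cong suc (+-suc m d)) (shorter m d)
shape (suc n) (suc m) _ _ _ | tri> _ _ n<m with m≤n⇒∃[o]m+o≡n n<m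
...   | e , refl with e ≤? n
...     | yes e≤n with m≤n⇒∃[o]m+o≡n e≤n
...       | x , refl = subst (Shape (suc (e + x))) (arith e x) (between e x)
  where
  arith : ∀ e x → suc e + x + suc e ≡ suc (suc (e + x) + e)
  arith = solve-∀
shape (suc n) (suc m) _ _ _ | tri> _ _ n<m | e , refl | no e≰n with m≤n⇒∃[o]m+o≡n (≰⇒> e≰n)
...       | s , refl = subst (Shape (suc n)) (arith n s) (longer n s)
  where
  arith : ∀ n s → suc n + suc n + suc s ≡ suc (suc n + suc (n + s))
  arith = solve-∀

Interior : {X : Set} → (ℕ → X) → ℕ → Set
Interior f B = Σ ℕ λ j → Σ ℕ λ L → ZAt f (suc j) (suc L) × suc j + (suc L + suc L + suc L) ≤ B

interior-Z : {X : Set} (f : ℕ → X) (B : ℕ) {n m : ℕ} → Shape n m →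
             Pal f 0 n → Rep f 0 n → Pal f 0 m → n + n + n ≤ B → m + m ≤ B → Interior f B
interior-Z f B (shorter m d) palN repN palM n≤B _ =
  d + suc d , m , z-shorter f (suc m) d palN repN palM , ≤-trans (≤-from-sum (arith m d)) n≤B
  where
  arith : ∀ m d → suc d + suc d + (suc m + suc m + suc m) + suc d ≡ (suc m + suc d) + (suc m + suc d) + (suc m + suc d)
  arith = solve-∀
interior-Z f B (between d x) palN _ palM _ m≤B =
  d + x , d , z-between f (suc d) x palN palM , ≤-trans (≤-from-sum (arith d x)) m≤B
  where
  arith : ∀ d x → (suc d + x) + (suc d + suc d + suc d) + x ≡ (suc d + x + suc d) + (suc d + x + suc d)
  arith = solve-∀
interior-Z f B (longer n s) palN repN palM _ m≤B =
  n + (suc s + suc s) , n , z-longer f (suc n) (suc s) palN repN palM , ≤-trans (≤-from-sum (arith n s)) m≤B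
  where
  arith : ∀ n s → suc n + (suc s + suc s) + (suc n + suc n + suc n) + 0 ≡ (suc n + suc n + suc s) + (suc n + suc n + suc s)
  arith = solve-∀

-- Lists: elementary facts, and the transfer to sequences through ix.
module _ {A : Set} where

  ++-assoc₃ : ∀ (a b c d : List A) → (a ++ b ++ c) ++ d ≡ a ++ b ++ c ++ d
  ++-assoc₃ a b c d = trans (++-assoc a (b ++ c) d) (cong (a ++_) (++-assoc b c d))

  reverse-infix : ∀ (u s v : List A) → reverse (u ++ s ++ v) ≡ reverse v ++ reverse s ++ reverse u
  reverse-infix u s v =
    begin
      reverse (u ++ s ++ v)               ≡⟨ reverse-++ u (s ++ v) ⟩
      reverse (s ++ v) ++ reverse u       ≡⟨ cong (_++ reverse u) (reverse-++ s v) ⟩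
      (reverse v ++ reverse s) ++ reverse u ≡⟨ ++-assoc (reverse v) (reverse s) (reverse u) ⟩
      reverse v ++ reverse s ++ reverse u ∎
    where open ≡-Reasoning

  reverse-nonempty : {y : List A} → y ≢ [] → reverse y ≢ []
  reverse-nonempty y≢[] e = y≢[] (reverse-injective e)

  length-nonempty : {xs : List A} → xs ≢ [] → length xs ≢ 0
  length-nonempty {[]}    xs≢[] _ = xs≢[] refl
  length-nonempty {_ ∷ _} _     ()

  length-pal : ∀ (x : List A) → length (x ++ reverse x) ≡ length x + length x
  length-pal x = trans (length-++ x) (cong (length x +_) (length-reverse x))

  length-Z : ∀ (x : List A) → length (x ++ reverse x ++ x) ≡ length x + length x + length x
  length-Z x =
    begin
      length (x ++ reverse x ++ x)                   ≡⟨ length-++ x ⟩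
      length x + length (reverse x ++ x)             ≡⟨ cong (length x +_) (length-++ (reverse x)) ⟩
      length x + (length (reverse x) + length x)     ≡⟨ cong (λ n → length x + (n + length x)) (length-reverse x) ⟩
      length x + (length x + length x)               ≡⟨ sym (+-assoc (length x) (length x) (length x)) ⟩
      length x + length x + length x                 ∎
    where open ≡-Reasoning

  prefix-length : ∀ {r} (p q : List A) → r ≡ p ++ q → length p ≤ length r
  prefix-length p q refl = length-++-≤ˡ p

  ++-equal-prefix : ∀ (a b s s′ : List A) → length a ≡ length b → a ++ s ≡ b ++ s′ → a ≡ b × s ≡ s′
  ++-equal-prefix []      []      s s′ _ e = refl , e
  ++-equal-prefix (x ∷ a) (y ∷ b) s s′ l e with ∷-injective e
  ... | refl , e′ with ++-equal-prefix a b s s′ (suc-injective l) e′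
  ...   | refl , s≡s′ = refl , s≡s′

  ++-equal-suffix : ∀ (a b s s′ : List A) → a ++ s ≡ b ++ s′ → length s ≡ length s′ → a ≡ b × s ≡ s′
  ++-equal-suffix a b s s′ e l = ++-equal-prefix a b s s′ (+-cancelʳ-≡ (length s) (length a) (length b) lengths) e
    where
    lengths : length a + length s ≡ length b + length s
    lengths = trans (sym (length-++ a)) (trans (cong length e) (trans (length-++ b) (cong (length b +_) (sym l))))

  init-last : ∀ (b : A) v → Σ (List A) λ v′ → Σ A λ c → b ∷ v ≡ v′ ∷ʳ c
  init-last b []       = [] , b , refl
  init-last b (b′ ∷ v) with init-last b′ v
  ... | v′ , c , e = b ∷ v′ , c , cong (b ∷_) e

  reducible-from-infix : ∀ {r} u y v → y ≢ [] → r ≡ u ++ (y ++ reverse y ++ y) ++ v → Reducible r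
  reducible-from-infix u y v y≢[] e =
    u , y , v , y≢[] , trans e (cong (u ++_) (++-assoc₃ y (reverse y) y v))

  -- reducibility is invariant under reversal: the reverse of y ȳ y is the Z-shape ȳ y ȳ
  reducible-reverse : {r : List A} → Reducible r → Reducible (reverse r)
  reducible-reverse (u , y , v , y≢[] , refl) = reducible-from-infix (reverse v) (reverse y) (reverse u) (reverse-nonempty y≢[]) chain
    where
    open ≡-Reasoning
    chain : reverse (u ++ y ++ reverse y ++ y ++ v) ≡ reverse v ++ (reverse y ++ reverse (reverse y) ++ reverse y) ++ reverse u
    chain =
      begin
        reverse (u ++ y ++ reverse y ++ y ++ v)           ≡⟨ cong (λ t → reverse (u ++ t)) (sym (++-assoc₃ y (reverse y) y v)) ⟩
        reverse (u ++ (y ++ reverse y ++ y) ++ v)         ≡⟨ reverse-infix u _ v ⟩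
        reverse v ++ reverse (y ++ reverse y ++ y) ++ reverse u
                                                          ≡⟨ cong (λ t → reverse v ++ t ++ reverse u) (reverse-infix y (reverse y) y) ⟩
        reverse v ++ (reverse y ++ reverse (reverse y) ++ reverse y) ++ reverse u ∎

  reducible-unreverse : (r : List A) → Reducible (reverse r) → Reducible r
  reducible-unreverse r red = subst Reducible (reverse-involutive r) (reducible-reverse red)

  ix : List A → ℕ → Maybe A
  ix []       _       = nothing
  ix (a ∷ xs) zero    = just a
  ix (a ∷ xs) (suc i) = ix xs i

  ix-++ˡ : ∀ xs ys {i} → i < length xs → ix (xs ++ ys) i ≡ ix xs i
  ix-++ˡ (a ∷ xs) ys {zero}  _         = refl
  ix-++ˡ (a ∷ xs) ys {suc i} (s≤s i<n) = ix-++ˡ xs ys i<n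

  ix-++ʳ : ∀ xs ys {n} k → length xs ≡ n → ix (xs ++ ys) (n + k) ≡ ix ys k
  ix-++ʳ []       ys k refl = refl
  ix-++ʳ (a ∷ xs) ys k refl = ix-++ʳ xs ys k refl

  ix-reverse : ∀ xs {i k} → suc (i + k) ≡ length xs → ix (reverse xs) i ≡ ix xs k
  ix-reverse (a ∷ xs) {i} {zero} h =
    begin
      ix (reverse (a ∷ xs)) i                 ≡⟨ cong (λ r → ix r i) (unfold-reverse a xs) ⟩
      ix (reverse xs ++ a ∷ []) i             ≡⟨ cong (ix (reverse xs ++ a ∷ [])) (sym (+-identityʳ i)) ⟩
      ix (reverse xs ++ a ∷ []) (i + 0)       ≡⟨ ix-++ʳ (reverse xs) (a ∷ []) 0 (trans (length-reverse xs) (sym (trans (sym (+-identityʳ i)) (suc-injective h)))) ⟩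
      just a                                  ∎
    where open ≡-Reasoning
  ix-reverse (a ∷ xs) {i} {suc k} h =
    begin
      ix (reverse (a ∷ xs)) i     ≡⟨ cong (λ r → ix r i) (unfold-reverse a xs) ⟩
      ix (reverse xs ++ a ∷ []) i ≡⟨ ix-++ˡ (reverse xs) (a ∷ []) (subst (i <_) (sym (length-reverse xs)) (subst (i <_) h′ (s≤s (m≤m+n i k)))) ⟩
      ix (reverse xs) i           ≡⟨ ix-reverse xs h′ ⟩
      ix xs k                     ∎
    where
    open ≡-Reasoning
    h′ : suc (i + k) ≡ length xs
    h′ = suc-injective (trans (cong suc (sym (+-suc i k))) h)

  pal-prefix : ∀ {r} q rest → r ≡ q ++ reverse q ++ rest → Pal (ix r) 0 (length q)
  pal-prefix q rest refl = pal-from-half (ix (q ++ reverse q ++ rest)) 0 (length q) half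
    where
    half : ∀ i k → i < length q → suc (i + k) ≡ length q + length q →
           ix (q ++ reverse q ++ rest) i ≡ ix (q ++ reverse q ++ rest) k
    half i k i<q h with mirror-of-first-half i<q h
    ... | y , hy , refl =
      begin
        ix (q ++ reverse q ++ rest) i              ≡⟨ ix-++ˡ q _ i<q ⟩
        ix q i                                     ≡⟨ sym (ix-reverse q (mirror i y hy)) ⟩
        ix (reverse q) y                           ≡⟨ sym (ix-++ˡ (reverse q) rest (subst (y <_) (sym (length-reverse q)) (mirror-below hy))) ⟩
        ix (reverse q ++ rest) y                   ≡⟨ sym (ix-++ʳ q _ y refl) ⟩
        ix (q ++ reverse q ++ rest) (length q + y) ∎
      where open ≡-Reasoning

  rep-prefix : ∀ {r} t rest → r ≡ t ++ reverse t ++ t ++ rest → Rep (ix r) 0 (length t)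
  rep-prefix t rest refl i i<t =
    begin
      ix (t ++ reverse t ++ t ++ rest) i                 ≡⟨ ix-++ˡ t _ i<t ⟩
      ix t i                                             ≡⟨ sym (ix-++ˡ t rest i<t) ⟩
      ix (t ++ rest) i                                   ≡⟨ sym (ix-++ʳ (reverse t) _ i (length-reverse t)) ⟩
      ix (reverse t ++ t ++ rest) (length t + i)         ≡⟨ sym (ix-++ʳ t _ (length t + i) refl) ⟩
      ix (t ++ reverse t ++ t ++ rest) (length t + (length t + i))
                                                         ≡⟨ cong (ix (t ++ reverse t ++ t ++ rest)) (sym (+-assoc (length t) (length t) i)) ⟩
      ix (t ++ reverse t ++ t ++ rest) (length t + length t + i) ∎
    where open ≡-Reasoning

  window : ∀ r j L → j + L ≤ length r → Σ (List A) λ y → length y ≡ L × (∀ i → i < L → ix y i ≡ ix r (j + i))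
  window r        zero    zero    _         = [] , refl , λ _ ()
  window (a ∷ r)  zero    (suc L) (s≤s le) with window r zero L le
  ... | y , refl , agree = a ∷ y , refl , λ { zero _ → refl ; (suc i) (s≤s i<L) → agree i i<L }
  window (a ∷ r)  (suc j) L       (s≤s le) = window r j L le

  prefix-from-ix : ∀ r s → (∀ i → i < length s → ix r i ≡ ix s i) → Σ (List A) λ v → r ≡ s ++ v
  prefix-from-ix r       []      _     = r , refl
  prefix-from-ix []      (b ∷ s) agree with agree 0 (s≤s z≤n)
  ... | ()
  prefix-from-ix (a ∷ r) (b ∷ s) agree with agree 0 (s≤s z≤n)
  ... | refl with prefix-from-ix r s (λ i i<s → agree (suc i) (s≤s i<s))
  ...   | v , e = v , cong (a ∷_) e

  infix-from-ix : ∀ r s j → (∀ i → i < length s → ix r (j + i) ≡ ix s i) →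
                  Σ (List A) λ u → Σ (List A) λ v → r ≡ u ++ s ++ v
  infix-from-ix r       s zero    agree with prefix-from-ix r s agree
  ... | v , e = [] , v , e
  infix-from-ix []      [] (suc j) _ = [] , [] , refl
  infix-from-ix []      (b ∷ s) (suc j) agree with agree 0 (s≤s z≤n)
  ... | ()
  infix-from-ix (a ∷ r) s (suc j) agree with infix-from-ix r s j agree
  ... | u , v , e = a ∷ u , v , cong (a ∷_) e

  z-pattern : (g : ℕ → Maybe A) (y : List A) {L : ℕ} → length y ≡ L →
              (∀ i → i < L → ix y i ≡ g i) → ZAt g 0 L →
              ∀ i → i < L + L + L → ix (y ++ reverse y ++ y) i ≡ g i
  z-pattern g y {L} ly agree (pal , rep) i i<3L with i <? L
  ... | yes i<L = trans (ix-++ˡ y _ (subst (i <_) (sym ly) i<L)) (agree i i<L)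
  ... | no i≮L with m≤n⇒∃[o]m+o≡n (≮⇒≥ i≮L)
  ...   | k , refl with k <? L
  ...     | yes k<L with m≤n⇒∃[o]m+o≡n k<L
  ...       | k′ , hk =
    begin
      ix (y ++ reverse y ++ y) (L + k) ≡⟨ ix-++ʳ y _ k ly ⟩
      ix (reverse y ++ y) k            ≡⟨ ix-++ˡ (reverse y) y (subst (k <_) (sym (trans (length-reverse y) ly)) k<L) ⟩
      ix (reverse y) k                 ≡⟨ ix-reverse y (trans hk (sym ly)) ⟩
      ix y k′                          ≡⟨ agree k′ (mirror-below hk) ⟩
      g k′                             ≡⟨ sym (pal (L + k) k′ (trans (cong suc (+-assoc L k k′)) (trans (sym (+-suc L (k + k′))) (cong (L +_) hk)))) ⟩
      g (L + k)                        ∎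
    where open ≡-Reasoning
  z-pattern g y {L} ly agree (pal , rep) _ i<3L | no _ | k , refl | no k≮L with m≤n⇒∃[o]m+o≡n (≮⇒≥ k≮L)
  ...       | k″ , refl =
    begin
      ix (y ++ reverse y ++ y) (L + (L + k″)) ≡⟨ ix-++ʳ y _ (L + k″) ly ⟩
      ix (reverse y ++ y) (L + k″)            ≡⟨ ix-++ʳ (reverse y) y k″ (trans (length-reverse y) ly) ⟩
      ix y k″                                 ≡⟨ agree k″ k″<L ⟩
      g k″                                    ≡⟨ rep k″ k″<L ⟩
      g (L + L + k″)                          ≡⟨ cong g (+-assoc L L k″) ⟩
      g (L + (L + k″))                        ∎
    where
    open ≡-Reasoning
    k″<L : k″ < L
    k″<L = +-cancelˡ-< (L + L) k″ L (subst (_< L + L + L) (sym (+-assoc L L k″)) i<3L)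

  z-reducible : ∀ r j L → ZAt (ix r) j (suc L) → j + (suc L + suc L + suc L) ≤ length r → Reducible r
  z-reducible r j L z fits with window r j (suc L) (≤-trans (+-monoʳ-≤ j (m≤n+m (suc L) (suc L + suc L))) fits)
  ... | y , ly , agree with infix-from-ix r (y ++ reverse y ++ y) j agreement
    where
    agreement : ∀ i → i < length (y ++ reverse y ++ y) → ix r (j + i) ≡ ix (y ++ reverse y ++ y) i
    agreement i i<3L = sym (z-pattern (λ i → ix r (j + i)) y ly agree z i
                         (subst (i <_) (trans (length-Z y) (cong (λ n → n + n + n) ly)) i<3L))
  ... | u , v , e = reducible-from-infix u y v y≢[] e
    where
    y≢[] : y ≢ []
    y≢[] y≡[] = 0≢1+n (trans (sym (cong length y≡[])) ly)

module PPIrreducibleString {A : Set} {w w′ : List A} {a : A} (w≡w′a : w ≡ w′ ++ a ∷ []) (irr : Irreducible w′) where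

  -- a Z-shape occurrence that does not end w lies within w′
  occurrence-is-suffix : ∀ u z v → ZOccurrence w u z v → v ≡ []
  occurrence-is-suffix _ _ []      _ = refl
  occurrence-is-suffix u _ (b ∷ v) (w≡uzv , x , x≢[] , refl) with init-last b v
  ... | v′ , c , bv≡v′c = ⊥-elim (irr (reducible-from-infix u x v′ x≢[] (∷ʳ-injectiveˡ w′ _ chain)))
    where
    open ≡-Reasoning
    z = x ++ reverse x ++ x
    chain : w′ ∷ʳ a ≡ (u ++ z ++ v′) ∷ʳ c
    chain =
      begin
        w′ ∷ʳ a               ≡⟨ sym w≡w′a ⟩
        w                     ≡⟨ w≡uzv ⟩
        u ++ z ++ b ∷ v       ≡⟨ cong (λ t → u ++ z ++ t) bv≡v′c ⟩
        u ++ z ++ v′ ∷ʳ c     ≡⟨ sym (++-assoc₃ u z v′ (c ∷ [])) ⟩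
        (u ++ z ++ v′) ∷ʳ c   ∎

  ends-in-Z : Reducible w → Σ (List A) λ u → Σ (List A) λ y → y ≢ [] × w ≡ u ++ y ++ reverse y ++ y
  ends-in-Z (u , y , v , y≢[] , w≡uyȳyv) with occurrence-is-suffix u _ v occurrence
    where
    occurrence : ZOccurrence w u (y ++ reverse y ++ y) v
    occurrence = trans w≡uyȳyv (cong (u ++_) (sym (++-assoc₃ y (reverse y) y v))) , y , y≢[] , refl
  ... | refl = u , y , y≢[] , trans w≡uyȳyv (cong (λ t → u ++ y ++ reverse y ++ t) (++-identityʳ y))

  module ZSuffix {u y : List A} (y≢[] : y ≢ []) (w≡uyȳy : w ≡ u ++ y ++ reverse y ++ y) where

    -- w read backwards: its last letter a followed by reverse w′
    r : List A
    r = a ∷ reverse w′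

    reverse-w : reverse w ≡ r
    reverse-w = trans (cong reverse w≡w′a) (reverse-++ w′ (a ∷ []))

    r-Z : r ≡ reverse y ++ reverse (reverse y) ++ reverse y ++ reverse u
    r-Z =
      begin
        r                                                 ≡⟨ sym reverse-w ⟩
        reverse w                                         ≡⟨ cong reverse w≡uyȳy ⟩
        reverse (u ++ y ++ reverse y ++ y)                ≡⟨ reverse-++ u _ ⟩
        reverse (y ++ reverse y ++ y) ++ reverse u        ≡⟨ cong (_++ reverse u) (reverse-infix y (reverse y) y) ⟩
        (reverse y ++ reverse (reverse y) ++ reverse y) ++ reverse u
                                                          ≡⟨ ++-assoc₃ (reverse y) (reverse (reverse y)) (reverse y) (reverse u) ⟩
        reverse y ++ reverse (reverse y) ++ reverse y ++ reverse u ∎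
      where open ≡-Reasoning

    -- every nonempty palindromic suffix x x̄ of w has |x| = |y|: otherwise the
    -- prefixes ȳ y ȳ and x x̄ of r force a Z-shape in reverse w′
    palindrome-half-length : ∀ u′ x → x ≢ [] → w ≡ u′ ++ x ++ reverse x → length x ≡ length y
    palindrome-half-length u′ x x≢[] w≡u′xx̄ with length x ≟ length (reverse y)
    ... | yes |x|≡|ȳ| = trans |x|≡|ȳ| (length-reverse y)
    ... | no |x|≢|ȳ|
      with interior-Z (ix r) (length r)
             (shape (length (reverse y)) (length x) (length-nonempty (reverse-nonempty y≢[])) (length-nonempty x≢[]) (|x|≢|ȳ| ∘ sym))
             (pal-prefix (reverse y) _ r-Z) (rep-prefix (reverse y) _ r-Z) (pal-prefix x _ r-X) Z-fits pal-fits
      where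
      r-X : r ≡ x ++ reverse x ++ reverse u′
      r-X = trans (sym reverse-w) (trans (cong reverse w≡u′xx̄)
              (trans (reverse-infix u′ x (reverse x)) (cong (_++ reverse x ++ reverse u′) (reverse-involutive x))))
      Z-fits : length (reverse y) + length (reverse y) + length (reverse y) ≤ length r
      Z-fits = subst (_≤ length r) (length-Z (reverse y))
                 (prefix-length _ (reverse u) (trans r-Z (sym (++-assoc₃ (reverse y) (reverse (reverse y)) (reverse y) (reverse u)))))
      pal-fits : length x + length x ≤ length r
      pal-fits = subst (_≤ length r) (length-pal x) (prefix-length _ (reverse u′) (trans r-X (sym (++-assoc x _ _))))
    ... | j , L , z , fits = ⊥-elim (irr (reducible-unreverse w′ (z-reducible (reverse w′) j L z (≤-pred fits))))

    w≡uy++ȳy : w ≡ (u ++ y) ++ reverse y ++ y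
    w≡uy++ȳy = trans w≡uyȳy (sym (++-assoc u y _))

    palindromic-suffix : NonemptyPalSuffix w (reverse y ++ y)
    palindromic-suffix = (λ e → y≢[] (++-conicalʳ (reverse y) y e)) , (u ++ y , w≡uy++ȳy) ,
                         (reverse y , cong (reverse y ++_) (sym (reverse-involutive y)))

    palindromic-suffix-unique : ∀ s → NonemptyPalSuffix w s → s ≡ reverse y ++ y
    palindromic-suffix-unique _ (s≢[] , (u′ , w≡u′s) , (x , refl)) =
      proj₂ (++-equal-suffix u′ (u ++ y) _ _ (trans (sym w≡u′s) w≡uy++ȳy) lengths)
      where
      x≢[] : x ≢ []
      x≢[] refl = s≢[] refl
      lengths : length (x ++ reverse x) ≡ length (reverse y ++ y)
      lengths =
        begin
          length (x ++ reverse x)          ≡⟨ length-pal x ⟩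
          length x + length x              ≡⟨ cong (λ n → n + n) (palindrome-half-length u′ x x≢[] w≡u′s) ⟩
          length y + length y              ≡⟨ cong (_+ length y) (sym (length-reverse y)) ⟩
          length (reverse y) + length y    ≡⟨ sym (length-++ (reverse y)) ⟩
          length (reverse y ++ y)          ∎
        where open ≡-Reasoning

    z-occurrence : ZOccurrence w u (y ++ reverse y ++ y) []
    z-occurrence = trans w≡uyȳy (cong (u ++_) (sym (++-identityʳ _))) , y , y≢[] , refl

    -- ... and the only one: any occurrence u′ x x̄ x ends w, so x̄ x is a
    -- palindromic suffix and |x| = |y|
    z-occurrence-unique : ∀ u′ z v → ZOccurrence w u′ z v → u′ ≡ u × z ≡ y ++ reverse y ++ y
    z-occurrence-unique u′ _ v occ@(w≡u′zv , x , x≢[] , refl) with occurrence-is-suffix u′ _ v occ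
    ... | refl = ++-equal-suffix u′ u _ _ (trans (sym w≡u′z) w≡uyȳy) lengths
      where
      open ≡-Reasoning
      w≡u′z : w ≡ u′ ++ x ++ reverse x ++ x
      w≡u′z = trans w≡u′zv (cong (u′ ++_) (++-identityʳ _))
      w≡u′x++x̄x : w ≡ (u′ ++ x) ++ reverse x ++ reverse (reverse x)
      w≡u′x++x̄x =
        begin
          w                                         ≡⟨ w≡u′z ⟩
          u′ ++ x ++ reverse x ++ x                 ≡⟨ sym (++-assoc u′ x _) ⟩
          (u′ ++ x) ++ reverse x ++ x               ≡⟨ cong (λ t → (u′ ++ x) ++ reverse x ++ t) (sym (reverse-involutive x)) ⟩
          (u′ ++ x) ++ reverse x ++ reverse (reverse x) ∎
      |x|≡|y| : length x ≡ length y
      |x|≡|y| = trans (sym (length-reverse x)) (palindrome-half-length (u′ ++ x) (reverse x) (reverse-nonempty x≢[]) w≡u′x++x̄x)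
      lengths : length (x ++ reverse x ++ x) ≡ length (y ++ reverse y ++ y)
      lengths = trans (length-Z x) (trans (cong (λ n → n + n + n) |x|≡|y|) (sym (length-Z y)))

lemma1 : {A : Set} (w : List A) → SSReducible w →
    (Σ (List A) λ s → NonemptyPalSuffix w s × ((s' : List A) → NonemptyPalSuffix w s' → s' ≡ s))
    × (Σ (List A) λ u → Σ (List A) λ z → ZOccurrence w u z []
        × ((u' z' v' : List A) → ZOccurrence w u' z' v' → u' ≡ u × z' ≡ z))
lemma1 w (reducible , (w′ , a , w≡w′a , irr)) with PPIrreducibleString.ends-in-Z w≡w′a irr reducible
... | u , y , y≢[] , w≡uyȳy =
      (reverse y ++ y , palindromic-suffix , palindromic-suffix-unique)
    , (u , y ++ reverse y ++ y , z-occurrence , z-occurrence-unique)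
  where open PPIrreducibleString.ZSuffix w≡w′a irr {u} y≢[] w≡uyȳy
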